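{- Let $\Gamma$ be a $PT$-graph of type 2(c). Then there exists an ordering of the vertices of $\Gamma$ whose corresponding $(0,1,-1)$-matrix is an alternating sign matrix if and only if it is not the case that one of the two cycles of $\Gamma_P$ has length $2$ and the two vertices of $\Gamma_T$ lying in the other cycle are consecutive in that cycle.
   Context: A $PT$-graph of type 2(c) is a 2-arc-coloured digraph whose arcs are: blue arcs $\Gamma_P$ forming two vertex-disjoint directed cycles covering all vertices; and four further arcs forming $\Gamma_T$, namely red arcs $(u_1,v_1)$, $(u_2,v_2)$ and blue arcs $(u_1,v_2)$, $(u_2,v_1)$, where $u_1,u_2$ are distinct vertices of one cycle and $v_1,v_2$ are distinct vertices of the other cycle. Given an ordering $w_1,\dots,w_n$ of the vertices, the corresponding $(0,1,-1)$-matrix $A$ has $A_{ij}=1$ if $(w_i,w_j)$ is a blue arc, $-1$ if it is a red arc, $0$ otherwise. An alternating sign matrix is a square $(0,1,-1)$-matrix in which the non-zero entries of each row and column alternate in sign, beginning and ending with $+1$. Two vertices of a directed cycle are consecutive if they are joined by an arc of the cycle. -}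

module Defs where

open import Data.Nat using (ℕ; zero; suc; _≤_; _<_; z≤n; s≤s; >-nonZero)
open import Data.Nat.Properties using (≤-trans)
open import Data.Nat.DivMod using (_mod_)
open import Data.Fin using (Fin; toℕ)
open import Data.Fin.Properties using (any?) renaming (_≟_ to _≟ᶠ_)
open import Data.Integer using (ℤ; 0ℤ; 1ℤ; -1ℤ) renaming (_≟_ to _≟ℤ_)
open import Data.List using (List; []; _∷_; filter)
open import Data.Vec.Functional using (toList)
open import Data.Product using (Σ; ∃; _×_; _,_)
open import Data.Product.Relation.Unary.All using ()
open import Data.Sum using (_⊎_)
open import Data.Bool using (if_then_else_)
open import Function.Definitions using (Injective)
open import Relation.Nullary using (¬_; Dec; yes; no)
open import Relation.Nullary.Decidable using (⌊_⌋; _×-dec_; _⊎-dec_; ¬?)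
open import Relation.Binary.PropositionalEquality using (_≡_; _≢_)

cnext : (a : ℕ) → 2 ≤ a → Fin a → Fin a
cnext a h i = _mod_ (suc (toℕ i)) a {{>-nonZero (≤-trans (s≤s z≤n) h)}}

-- A PT-graph of type 2(c) on the vertex set Fin n.
-- Γ_P: two vertex-disjoint directed cycles c₁ (length a) and c₂ (length b)
-- covering all vertices; cycle arcs are c₁ i → c₁ (i+1 mod a), etc.
-- Γ_T: red arcs (u₁,v₁), (u₂,v₂) and blue arcs (u₁,v₂), (u₂,v₁) where
-- u₁ ≠ u₂ lie on cycle 1 and v₁ ≠ v₂ lie on cycle 2.
record PT2c (n : ℕ) : Set where
  field
    a b    : ℕ
    2≤a    : 2 ≤ a
    2≤b    : 2 ≤ b
    c₁     : Fin a → Fin n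
    c₂     : Fin b → Fin n
    c₁-inj : Injective _≡_ _≡_ c₁
    c₂-inj : Injective _≡_ _≡_ c₂
    disj   : ∀ i j → c₁ i ≢ c₂ j
    cover  : ∀ v → (∃ λ i → c₁ i ≡ v) ⊎ (∃ λ j → c₂ j ≡ v)
    u₁ u₂  : Fin a
    u₁≢u₂  : u₁ ≢ u₂
    v₁ v₂  : Fin b
    v₁≢v₂  : v₁ ≢ v₂

  next₁ : Fin a → Fin a
  next₁ = cnext a 2≤a

  next₂ : Fin b → Fin b
  next₂ = cnext b 2≤b

  Blue : Fin n → Fin n → Set
  Blue x y = (∃ λ i → x ≡ c₁ i × y ≡ c₁ (next₁ i))
           ⊎ (∃ λ j → x ≡ c₂ j × y ≡ c₂ (next₂ j))
           ⊎ (x ≡ c₁ u₁ × y ≡ c₂ v₂)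
           ⊎ (x ≡ c₁ u₂ × y ≡ c₂ v₁)

  Red : Fin n → Fin n → Set
  Red x y = (x ≡ c₁ u₁ × y ≡ c₂ v₁) ⊎ (x ≡ c₁ u₂ × y ≡ c₂ v₂)

  blue? : ∀ x y → Dec (Blue x y)
  blue? x y = any? (λ i → (x ≟ᶠ c₁ i) ×-dec (y ≟ᶠ c₁ (next₁ i)))
       ⊎-dec (any? (λ j → (x ≟ᶠ c₂ j) ×-dec (y ≟ᶠ c₂ (next₂ j)))
       ⊎-dec (((x ≟ᶠ c₁ u₁) ×-dec (y ≟ᶠ c₂ v₂))
       ⊎-dec ((x ≟ᶠ c₁ u₂) ×-dec (y ≟ᶠ c₂ v₁))))

  red? : ∀ x y → Dec (Red x y)
  red? x y = ((x ≟ᶠ c₁ u₁) ×-dec (y ≟ᶠ c₂ v₁)) ⊎-dec ((x ≟ᶠ c₁ u₂) ×-dec (y ≟ᶠ c₂ v₂))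

  matrix : (Fin n → Fin n) → Fin n → Fin n → ℤ
  matrix w i j = if ⌊ blue? (w i) (w j) ⌋ then 1ℤ
                 else (if ⌊ red? (w i) (w j) ⌋ then -1ℤ else 0ℤ)

  Consecutive₁ : Fin a → Fin a → Set
  Consecutive₁ x y = y ≡ next₁ x ⊎ x ≡ next₁ y

  Consecutive₂ : Fin b → Fin b → Set
  Consecutive₂ x y = y ≡ next₂ x ⊎ x ≡ next₂ y

  Exceptional : Set
  Exceptional = (a ≡ 2 × Consecutive₂ v₁ v₂) ⊎ (b ≡ 2 × Consecutive₁ u₁ u₂)

data Alternating : List ℤ → Set where
  alt-one  : Alternating (1ℤ ∷ [])
  alt-cons : ∀ {l} → Alternating l → Alternating (1ℤ ∷ -1ℤ ∷ l)

nonzeros : List ℤ → List ℤ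
nonzeros = filter (λ z → ¬? (z ≟ℤ 0ℤ))

IsASM : ∀ {n} → (Fin n → Fin n → ℤ) → Set
IsASM {n} M =
    (∀ i j → M i j ≡ 0ℤ ⊎ M i j ≡ 1ℤ ⊎ M i j ≡ -1ℤ)
  × (∀ i → Alternating (nonzeros (toList (λ j → M i j))))
  × (∀ j → Alternating (nonzeros (toList (λ i → M i j))))

module Submission where

-- Read row x of the matrix as the out-arcs of vertex x and column y as its in-arcs. Every line
-- then has a single +1, except the rows of u₁, u₂ and the columns of v₁, v₂, which carry +1, +1
-- and −1; such a line alternates iff its −1 lies strictly between its two +1s. Writing x⁺ and x⁻
-- for the successor and predecessor of x on its cycle, an ordering therefore gives an ASM iff
-- u₁⁺, v₁, v₂, u₂⁺ and v₁⁻, u₁, u₂, v₂⁻ both appear in monotone order. The only coincidences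
-- possible among these eight vertices are u₁⁺ = u₂, u₂⁺ = u₁, v₁⁻ = v₂ and v₂⁻ = v₁, and the
-- exceptional configuration is exactly the case that at least three of them hold, which makes
-- the two chains clash. Otherwise an explicit placement of the eight vertices works, and ranking
-- all vertices by a key extending it produces the ordering.

open import Defs
open import Data.Nat as ℕ using (ℕ; zero; suc; _+_; _≤_; _<_; _<?_; z≤n; s≤s; NonZero; >-nonZero)
import Data.Nat.Properties as ℕ
open import Data.Nat.DivMod using (_%_; m<n⇒m%n≡m; n%n≡0)
open import Data.Fin as Fin using (Fin; toℕ; fromℕ<; punchOut) renaming (_≟_ to _≟ᶠ_)
open import Data.Fin.Properties as Fin using (toℕ-fromℕ<; toℕ-injective; toℕ<n; punchOut-injective; injective⇒≤; any?)
open import Data.Integer using (ℤ; 0ℤ; 1ℤ; -1ℤ) renaming (_≟_ to _≟ℤ_)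
open import Data.Bool using (Bool; if_then_else_)
open import Data.Unit using (⊤; tt)
open import Data.Empty using (⊥-elim)
open import Data.Product using (Σ; ∃; _×_; _,_; proj₁; proj₂)
open import Data.Product.Relation.Binary.Lex.Strict using (×-Lex; ×-transitive; ×-compare)
open import Data.Sum as Sum using (_⊎_; inj₁; inj₂)
open import Data.List using (List; []; _∷_; map)
open import Data.List.Properties using (filter-accept; filter-reject; map-∘)
open import Data.List.Membership.Propositional using (_∈_; _∉_)
open import Data.List.Membership.Propositional.Properties using (∈-map⁺; ∈-map⁻)
open import Data.List.Relation.Unary.Any using (here; there)
open import Data.List.Relation.Unary.All as All using (All; []; _∷_)
import Data.List.Relation.Unary.All.Properties as All
open import Data.List.Relation.Unary.AllPairs using (_∷_)
open import Data.List.Relation.Unary.Linked as Linked using (Linked; []; [-]; _∷_)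
open import Data.List.Relation.Unary.Linked.Properties using (Linked⇒AllPairs)
import Data.List.Relation.Binary.Permutation.Propositional as ↭
open import Data.List.Relation.Binary.Permutation.Propositional.Properties using (∈-resp-↭)
open import Data.Vec.Functional using (toList)
open import Function using (id; _∘_; _on_)
open import Function.Bundles using (_⇔_; mk⇔; Equivalence)
open import Function.Definitions using (Injective; Bijective)
open import Level using (0ℓ)
open import Relation.Nullary using (¬_; Dec; yes; no; does; ¬?)
open import Relation.Nullary.Decidable using (True; toWitness; dec-true; dec-false; _×-dec_; _⊎-dec_)
open import Relation.Unary using (Pred; Decidable; _⊆_)
open import Relation.Binary using (Rel; IsStrictTotalOrder; Trichotomous; tri<; tri≈; tri>)
open import Relation.Binary.Definitions using (DecidableEquality)
open import Relation.Binary.PropositionalEquality using (_≡_; _≢_; refl; sym; trans; cong; subst; isEquivalence; resp₂)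

Between : ℕ → ℕ → ℕ → Set
Between x m y = (x < m × m < y) ⊎ (y < m × m < x)

between? : ∀ x m y → Dec (Between x m y)
between? x m y = ((x <? m) ×-dec (m <? y)) ⊎-dec ((y <? m) ×-dec (m <? x))

between-sym : ∀ {x m y} → Between x m y → Between y m x
between-sym (inj₁ (x<m , m<y)) = inj₂ (x<m , m<y)
between-sym (inj₂ (y<m , m<x)) = inj₁ (y<m , m<x)

between-asym : ∀ {x m y} → Between x m y → ¬ Between m x y
between-asym (inj₁ (x<m , _))   (inj₁ (m<x , _))   = ℕ.<-asym x<m m<x
between-asym (inj₁ (x<m , m<y)) (inj₂ (y<x , _))   = ℕ.<-asym x<m (ℕ.<-trans m<y y<x)
between-asym (inj₂ (y<m , _))   (inj₁ (m<x , x<y)) = ℕ.<-asym y<m (ℕ.<-trans m<x x<y)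
between-asym (inj₂ (_ , m<x))   (inj₂ (_ , x<m))   = ℕ.<-asym x<m m<x

between-chain : ∀ {x y z w} → Between x y z → Between y z w → Between x z w
between-chain (inj₁ (x<y , y<z)) (inj₁ (_ , z<w))   = inj₁ (ℕ.<-trans x<y y<z , z<w)
between-chain (inj₁ (_ , y<z))   (inj₂ (_ , z<y))   = ⊥-elim (ℕ.<-asym y<z z<y)
between-chain (inj₂ (z<y , _))   (inj₁ (y<z , _))   = ⊥-elim (ℕ.<-asym y<z z<y)
between-chain (inj₂ (z<y , y<x)) (inj₂ (w<z , _))   = inj₂ (w<z , ℕ.<-trans z<y y<x)

between-map : ∀ {a} {A : Set a} {f g : A → ℕ} → (∀ {p q} → f p < f q → g p < g q) →
              ∀ {x m y} → Between (f x) (f m) (f y) → Between (g x) (g m) (g y)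
between-map mono (inj₁ (x<m , m<y)) = inj₁ (mono x<m , mono m<y)
between-map mono (inj₂ (y<m , m<x)) = inj₂ (mono y<m , mono m<x)

record Slots : Set where
  constructor slots
  field u₁ u₂ u₁⁺ u₂⁺ v₁ v₂ v₁⁻ v₂⁻ : ℕ

slots-≡ : ∀ {a₁ a₂ a₃ a₄ a₅ a₆ a₇ a₈ b₁ b₂ b₃ b₄ b₅ b₆ b₇ b₈} →
  a₁ ≡ b₁ → a₂ ≡ b₂ → a₃ ≡ b₃ → a₄ ≡ b₄ → a₅ ≡ b₅ → a₆ ≡ b₆ → a₇ ≡ b₇ → a₈ ≡ b₈ →
  slots a₁ a₂ a₃ a₄ a₅ a₆ a₇ a₈ ≡ slots b₁ b₂ b₃ b₄ b₅ b₆ b₇ b₈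
slots-≡ refl refl refl refl refl refl refl refl = refl

Chained : Slots → Set
Chained (slots u₁ u₂ u₁⁺ u₂⁺ v₁ v₂ v₁⁻ v₂⁻) =
  Between u₁⁺ v₁ v₂ × Between u₂⁺ v₂ v₁ × Between v₁⁻ u₁ u₂ × Between v₂⁻ u₂ u₁

chained? : ∀ s → Dec (Chained s)
chained? (slots u₁ u₂ u₁⁺ u₂⁺ v₁ v₂ v₁⁻ v₂⁻) =
  between? u₁⁺ v₁ v₂ ×-dec between? u₂⁺ v₂ v₁ ×-dec between? v₁⁻ u₁ u₂ ×-dec between? v₂⁻ u₂ u₁

AtLeastThree : Set → Set → Set → Set → Set
AtLeastThree A₁ A₂ A₃ A₄ = (A₁ × A₂ × (A₃ ⊎ A₄)) ⊎ (A₃ × A₄ × (A₁ ⊎ A₂))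

AtLeastThree-map : ∀ {A₁ A₂ A₃ A₄ B₁ B₂ B₃ B₄ : Set} →
  (A₁ → B₁) → (A₂ → B₂) → (A₃ → B₃) → (A₄ → B₄) → AtLeastThree A₁ A₂ A₃ A₄ → AtLeastThree B₁ B₂ B₃ B₄
AtLeastThree-map f₁ f₂ f₃ f₄ (inj₁ (x₁ , x₂ , x₃₄)) = inj₁ (f₁ x₁ , f₂ x₂ , Sum.map f₃ f₄ x₃₄)
AtLeastThree-map f₁ f₂ f₃ f₄ (inj₂ (x₃ , x₄ , x₁₂)) = inj₂ (f₃ x₃ , f₄ x₄ , Sum.map f₁ f₂ x₁₂)

chained⇒¬AtLeastThree : ∀ {u₁ u₂ u₁⁺ u₂⁺ v₁ v₂ v₁⁻ v₂⁻} →
  Chained (slots u₁ u₂ u₁⁺ u₂⁺ v₁ v₂ v₁⁻ v₂⁻) →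
  ¬ AtLeastThree (u₁⁺ ≡ u₂) (u₂⁺ ≡ u₁) (v₁⁻ ≡ v₂) (v₂⁻ ≡ v₁)
chained⇒¬AtLeastThree (b₁ , b₂ , b₃ , b₄) (inj₁ (refl , refl , inj₁ refl)) =
  between-asym b₃ (between-sym (between-chain b₁ (between-sym b₂)))
chained⇒¬AtLeastThree (b₁ , b₂ , b₃ , b₄) (inj₁ (refl , refl , inj₂ refl)) =
  between-asym b₄ (between-sym (between-chain b₂ (between-sym b₁)))
chained⇒¬AtLeastThree (b₁ , b₂ , b₃ , b₄) (inj₂ (refl , refl , inj₁ refl)) =
  between-asym b₁ (between-sym (between-chain b₃ (between-sym b₄)))
chained⇒¬AtLeastThree (b₁ , b₂ , b₃ , b₄) (inj₂ (refl , refl , inj₂ refl)) =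
  between-asym b₂ (between-sym (between-chain b₄ (between-sym b₃)))

coincide : Slots → Bool → Bool → Bool → Bool → Slots
coincide (slots u₁ u₂ u₁⁺ u₂⁺ v₁ v₂ v₁⁻ v₂⁻) b₁ b₂ b₃ b₄ =
  slots u₁ u₂ (if b₁ then u₂ else u₁⁺) (if b₂ then u₁ else u₂⁺)
        v₁ v₂ (if b₃ then v₂ else v₁⁻) (if b₄ then v₁ else v₂⁻)

private
  decide-chained : ∀ {s} {_ : True (chained? s)} → Chained s
  decide-chained {s} {c} = toWitness c

chained-placement : ∀ {A₁ A₂ A₃ A₄ : Set} (d₁ : Dec A₁) (d₂ : Dec A₂) (d₃ : Dec A₃) (d₄ : Dec A₄) →
  ¬ AtLeastThree A₁ A₂ A₃ A₄ → ∃ λ s → Chained (coincide s (does d₁) (does d₂) (does d₃) (does d₄))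
chained-placement (yes a₁) (yes a₂) (yes a₃) _        ¬3 = ⊥-elim (¬3 (inj₁ (a₁ , a₂ , inj₁ a₃)))
chained-placement (yes a₁) (yes a₂) (no _)   (yes a₄) ¬3 = ⊥-elim (¬3 (inj₁ (a₁ , a₂ , inj₂ a₄)))
chained-placement (yes a₁) (no _)   (yes a₃) (yes a₄) ¬3 = ⊥-elim (¬3 (inj₂ (a₃ , a₄ , inj₁ a₁)))
chained-placement (no _)   (yes a₂) (yes a₃) (yes a₄) ¬3 = ⊥-elim (¬3 (inj₂ (a₃ , a₄ , inj₂ a₂)))
-- Witnesses found by a search over the orderings of the eight slots.
chained-placement (no _)   (no _)   (no _)   (no _)   _ = slots 5 6 0 3 1 2 4 7 , decide-chained
chained-placement (no _)   (yes _)  (no _)   (no _)   _ = slots 5 6 0 3 1 2 4 7 , decide-chained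
chained-placement (no _)   (no _)   (yes _)  (no _)   _ = slots 5 6 0 3 1 2 4 7 , decide-chained
chained-placement (no _)   (yes _)  (yes _)  (no _)   _ = slots 5 6 0 3 1 2 4 7 , decide-chained
chained-placement (yes _)  (no _)   (no _)   (no _)   _ = slots 1 2 4 7 5 6 0 3 , decide-chained
chained-placement (no _)   (no _)   (no _)   (yes _)  _ = slots 1 2 4 7 5 6 0 3 , decide-chained
chained-placement (yes _)  (no _)   (no _)   (yes _)  _ = slots 1 2 4 7 5 6 0 3 , decide-chained
chained-placement (yes _)  (yes _)  (no _)   (no _)   _ = slots 3 6 0 1 5 4 2 7 , decide-chained
chained-placement (yes _)  (no _)   (yes _)  (no _)   _ = slots 3 5 0 1 4 2 6 7 , decide-chained
chained-placement (no _)   (yes _)  (no _)   (yes _)  _ = slots 5 3 0 1 2 4 6 7 , decide-chained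
chained-placement (no _)   (no _)   (yes _)  (yes _)  _ = slots 3 2 0 5 1 4 6 7 , decide-chained

count : ∀ {n p} {P : Pred (Fin n) p} → Decidable P → ℕ
count {zero}  P? = 0
count {suc n} P? = (if does (P? Fin.zero) then 1 else 0) + count (P? ∘ Fin.suc)

count-all : ∀ {n} → count {n} {P = λ _ → ⊤} (λ _ → yes tt) ≡ n
count-all {zero}  = refl
count-all {suc n} = cong suc count-all

count-mono : ∀ {n p q} {P : Pred (Fin n) p} {Q : Pred (Fin n) q} (P? : Decidable P) (Q? : Decidable Q) →
             P ⊆ Q → count P? ≤ count Q?
count-mono {zero}  _  _  _ = z≤n
count-mono {suc n} P? Q? P⊆Q with P? Fin.zero | Q? Fin.zero
... | yes _ | yes _  = s≤s (count-mono (P? ∘ Fin.suc) (Q? ∘ Fin.suc) P⊆Q)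
... | yes p | no ¬q  = ⊥-elim (¬q (P⊆Q p))
... | no _  | yes _  = ℕ.m≤n⇒m≤1+n (count-mono (P? ∘ Fin.suc) (Q? ∘ Fin.suc) P⊆Q)
... | no _  | no _   = count-mono (P? ∘ Fin.suc) (Q? ∘ Fin.suc) P⊆Q

count-strict : ∀ {n p q} {P : Pred (Fin n) p} {Q : Pred (Fin n) q} (P? : Decidable P) (Q? : Decidable Q) →
               P ⊆ Q → ∀ x → Q x → ¬ P x → count P? < count Q?
count-strict P? Q? P⊆Q Fin.zero qx ¬px with P? Fin.zero | Q? Fin.zero
... | yes px | _     = ⊥-elim (¬px px)
... | no _   | yes _ = s≤s (count-mono (P? ∘ Fin.suc) (Q? ∘ Fin.suc) P⊆Q)
... | no _   | no ¬q = ⊥-elim (¬q qx)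
count-strict P? Q? P⊆Q (Fin.suc x) qx ¬px with P? Fin.zero | Q? Fin.zero
... | yes _ | yes _  = s≤s (count-strict (P? ∘ Fin.suc) (Q? ∘ Fin.suc) P⊆Q x qx ¬px)
... | yes p | no ¬q  = ⊥-elim (¬q (P⊆Q p))
... | no _  | yes _  = ℕ.m<n⇒m<1+n (count-strict (P? ∘ Fin.suc) (Q? ∘ Fin.suc) P⊆Q x qx ¬px)
... | no _  | no _   = count-strict (P? ∘ Fin.suc) (Q? ∘ Fin.suc) P⊆Q x qx ¬px

injective⇒surjective : ∀ {m} (f : Fin m → Fin m) → Injective _≡_ _≡_ f → ∀ y → ∃ λ x → f x ≡ y
injective⇒surjective {suc m} f f-inj y with any? (λ x → f x Fin.≟ y)
... | yes found = found
... | no ¬found = ⊥-elim (ℕ.1+n≰n (injective⇒≤ g-inj))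
  where
  y≢f : ∀ x → y ≢ f x
  y≢f x y≡fx = ¬found (x , sym y≡fx)
  g : Fin (suc m) → Fin m
  g x = punchOut (y≢f x)
  g-inj : Injective _≡_ _≡_ g
  g-inj eq = f-inj (punchOut-injective (y≢f _) (y≢f _) eq)

KeyOrder : ∀ {n} → (Fin n → ℕ) → Rel (Fin n) 0ℓ
KeyOrder key = ×-Lex _≡_ _<_ Fin._<_ on (λ x → key x , x)

keyOrder-isStrictTotalOrder : ∀ {n} (key : Fin n → ℕ) → IsStrictTotalOrder _≡_ (KeyOrder key)
keyOrder-isStrictTotalOrder key = record
  { isStrictPartialOrder = record
    { isEquivalence = isEquivalence
    ; irrefl        = λ { refl (inj₁ k<k) → ℕ.<-irrefl refl k<k ; refl (inj₂ (_ , x<x)) → ℕ.<-irrefl refl x<x }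
    ; trans         = ×-transitive {_<₁_ = _<_} {_<₂_ = Fin._<_} isEquivalence (resp₂ _<_) ℕ.<-trans Fin.<-trans
    ; <-resp-≈      = resp₂ _
    }
  ; compare = compare
  }
  where
  compare : Trichotomous _≡_ (KeyOrder key)
  compare x y with ×-compare sym ℕ.<-cmp Fin.<-cmp (key x , x) (key y , y)
  ... | tri< lt ne gt = tri< lt (λ { refl → ne (refl , refl) }) gt
  ... | tri≈ lt (_ , eq) gt = tri≈ lt eq gt
  ... | tri> lt ne gt = tri> lt (λ { refl → ne (refl , refl) }) gt

module Ranking {n ℓ} {_≺_ : Rel (Fin n) ℓ} (≺-sto : IsStrictTotalOrder _≡_ _≺_) where
  open IsStrictTotalOrder ≺-sto using (irrefl; compare) renaming (trans to ≺-trans; _<?_ to _≺?_)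

  rank : Fin n → ℕ
  rank x = count (_≺? x)

  rank-mono : ∀ {x y} → x ≺ y → rank x < rank y
  rank-mono {x} {y} x≺y = count-strict (_≺? x) (_≺? y) (λ z≺x → ≺-trans z≺x x≺y) x x≺y (irrefl refl)

  rank<n : ∀ x → rank x < n
  rank<n x = subst (rank x <_) count-all (count-strict (_≺? x) (λ _ → yes tt) _ x tt (irrefl refl))

  position : Fin n → Fin n
  position x = fromℕ< (rank<n x)

  position-mono : ∀ {x y} → x ≺ y → toℕ (position x) < toℕ (position y)
  position-mono {x} {y} x≺y rewrite toℕ-fromℕ< (rank<n x) | toℕ-fromℕ< (rank<n y) = rank-mono x≺y

  position-injective : Injective _≡_ _≡_ position
  position-injective {x} {y} eq with compare x y
  ... | tri< x≺y _ _ = ⊥-elim (ℕ.<-irrefl (cong toℕ eq) (position-mono x≺y))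
  ... | tri≈ _ x≡y _ = x≡y
  ... | tri> _ _ y≺x = ⊥-elim (ℕ.<-irrefl (cong toℕ (sym eq)) (position-mono y≺x))

  ordering : Fin n → Fin n
  ordering i = proj₁ (injective⇒surjective position position-injective i)

  position∘ordering : ∀ i → position (ordering i) ≡ i
  position∘ordering i = proj₂ (injective⇒surjective position position-injective i)

  ordering∘position : ∀ x → ordering (position x) ≡ x
  ordering∘position x = position-injective (position∘ordering (position x))

  ordering-bijective : Bijective _≡_ _≡_ ordering
  ordering-bijective =
      (λ {i} {j} e → trans (sym (position∘ordering i)) (trans (cong position e) (position∘ordering j)))
    , (λ x → position x , λ { refl → ordering∘position x })

Alternates : ∀ {m} → (Fin m → ℤ) → Set
Alternates f = Alternating (nonzeros (toList f))

private
  ≡1⇒≢0 : ∀ {z} → z ≡ 1ℤ → z ≢ 0ℤ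
  ≡1⇒≢0 refl ()

  ≡-1⇒≢0 : ∀ {z} → z ≡ -1ℤ → z ≢ 0ℤ
  ≡-1⇒≢0 refl ()

  nonzeros-accept : ∀ {z zs} → z ≢ 0ℤ → nonzeros (z ∷ zs) ≡ z ∷ nonzeros zs
  nonzeros-accept = filter-accept (λ z → ¬? (z ≟ℤ 0ℤ))

  nonzeros-reject : ∀ {z zs} → ¬ z ≢ 0ℤ → nonzeros (z ∷ zs) ≡ nonzeros zs
  nonzeros-reject = filter-reject (λ z → ¬? (z ≟ℤ 0ℤ))

  ∈-map-suc⁻ : ∀ {m} {j : Fin m} {js} → Fin.suc j ∈ map Fin.suc js → j ∈ js
  ∈-map-suc⁻ p with ∈-map⁻ Fin.suc p
  ... | _ , j∈js , refl = j∈js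

  zero∉map-suc : ∀ {m} {js : List (Fin m)} → Fin.zero ∉ map Fin.suc js
  zero∉map-suc p with ∈-map⁻ Fin.suc p
  ... | _ , _ , ()

  unshift : ∀ {m} {is : List (Fin (suc m))} → All (Fin.zero {m} Fin.<_) is → Linked Fin._<_ is →
            ∃ λ js → map Fin.suc js ≡ is × Linked Fin._<_ js
  unshift [] [] = [] , refl , []
  unshift {is = Fin.suc i ∷ []} _ [-] = i ∷ [] , refl , [-]
  unshift {is = Fin.suc i ∷ _ ∷ _} (_ ∷ pos) (i<j ∷ sorted) with unshift pos sorted
  ... | j ∷ js , refl , sorted′ = i ∷ j ∷ js , refl , ℕ.s<s⁻¹ i<j ∷ sorted′

nonzeros-toList : ∀ {m} (f : Fin m → ℤ) {is : List (Fin m)} → Linked Fin._<_ is →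
                  All (λ i → f i ≢ 0ℤ) is → (∀ i → f i ≢ 0ℤ → i ∈ is) →
                  nonzeros (toList f) ≡ map f is

private
  nonzeros-toList-shift : ∀ {m} (f : Fin (suc m) → ℤ) (js : List (Fin m)) → Linked Fin._<_ js →
    All (λ i → f i ≢ 0ℤ) (map Fin.suc js) → (∀ j → f (Fin.suc j) ≢ 0ℤ → Fin.suc j ∈ map Fin.suc js) →
    nonzeros (toList (f ∘ Fin.suc)) ≡ map f (map Fin.suc js)
  nonzeros-toList-shift f js sorted nz supp =
    trans (nonzeros-toList (f ∘ Fin.suc) sorted (All.map⁻ nz) (λ j → ∈-map-suc⁻ ∘ supp j)) (map-∘ js)

nonzeros-toList {zero} f {[]} _ _ _ = refl
nonzeros-toList {suc m} f {[]} _ _ supp =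
  trans (nonzeros-reject λ f0≢0 → zero∉map-suc {js = []} (supp Fin.zero f0≢0))
        (nonzeros-toList-shift f [] [] [] (λ j → supp (Fin.suc j)))
nonzeros-toList {suc m} f {Fin.zero ∷ is} sorted (f0≢0 ∷ nz) supp
  with i<is ∷ _ ← Linked⇒AllPairs Fin.<-trans sorted
  with js , refl , sorted′ ← unshift i<is (Linked.tail sorted) =
  trans (nonzeros-accept f0≢0) (cong (f Fin.zero ∷_) (nonzeros-toList-shift f js sorted′ nz tail-supp))
  where
  tail-supp : ∀ j → f (Fin.suc j) ≢ 0ℤ → Fin.suc j ∈ map Fin.suc js
  tail-supp j fj≢0 with supp (Fin.suc j) fj≢0
  ... | there sj∈ = sj∈
nonzeros-toList {suc m} f {Fin.suc i ∷ is} sorted nz supp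
  with i<is ∷ _ ← Linked⇒AllPairs Fin.<-trans sorted
  with i′ ∷ js , refl , sorted′ ← unshift (s≤s z≤n ∷ All.map (Fin.<-trans (s≤s z≤n)) i<is) sorted =
  trans (nonzeros-reject λ f0≢0 → zero∉map-suc (supp Fin.zero f0≢0))
        (nonzeros-toList-shift f (i′ ∷ js) sorted′ nz (λ j → supp (Fin.suc j)))

alternating-single : ∀ {m} (f : Fin m → ℤ) {i} → f i ≡ 1ℤ → (∀ x → f x ≢ 0ℤ → x ∈ i ∷ []) →
                     Alternates f
alternating-single f fi≡1 supp
  rewrite nonzeros-toList f [-] (≡1⇒≢0 fi≡1 ∷ []) supp | fi≡1 = alt-one

private
  alternating-three-ordered : ∀ {m} (f : Fin m → ℤ) {i j k} → i Fin.< j →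
    f i ≡ 1ℤ → f j ≡ 1ℤ → f k ≡ -1ℤ → (∀ x → f x ≢ 0ℤ → x ∈ i ∷ j ∷ k ∷ []) →
    Alternates f ⇔ Between (toℕ i) (toℕ k) (toℕ j)
  alternating-three-ordered f {i} {j} {k} i<j fi fj fk supp
    with Fin.<-cmp k i | Fin.<-cmp k j
  ... | tri≈ _ refl _ | _ with () ← trans (sym fi) fk
  ... | _ | tri≈ _ refl _ with () ← trans (sym fj) fk
  ... | tri< k<i _ _ | _
    rewrite nonzeros-toList f (k<i ∷ i<j ∷ [-]) (≡-1⇒≢0 fk ∷ ≡1⇒≢0 fi ∷ ≡1⇒≢0 fj ∷ [])
              (λ x → ∈-resp-↭ (↭.trans (↭.prep i (↭.swap j k ↭.refl)) (↭.swap i k ↭.refl)) ∘ supp x)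
          | fi | fj | fk
    = mk⇔ (λ ()) (⊥-elim ∘ λ { (inj₁ (i<k , _)) → ℕ.<-asym i<k k<i
                             ; (inj₂ (j<k , _)) → ℕ.<-asym i<j (ℕ.<-trans j<k k<i) })
  ... | tri> _ _ i<k | tri< k<j _ _
    rewrite nonzeros-toList f (i<k ∷ k<j ∷ [-]) (≡1⇒≢0 fi ∷ ≡-1⇒≢0 fk ∷ ≡1⇒≢0 fj ∷ [])
              (λ x → ∈-resp-↭ (↭.prep i (↭.swap j k ↭.refl)) ∘ supp x)
          | fi | fj | fk
    = mk⇔ (λ _ → inj₁ (i<k , k<j)) (λ _ → alt-cons alt-one)
  ... | tri> _ _ i<k | tri> _ _ j<k
    rewrite nonzeros-toList f (i<j ∷ j<k ∷ [-]) (≡1⇒≢0 fi ∷ ≡1⇒≢0 fj ∷ ≡-1⇒≢0 fk ∷ []) supp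
          | fi | fj | fk
    = mk⇔ (λ ()) (⊥-elim ∘ λ { (inj₁ (_ , k<j)) → ℕ.<-asym k<j j<k
                             ; (inj₂ (_ , k<i)) → ℕ.<-asym i<k k<i })

alternating-three : ∀ {m} (f : Fin m → ℤ) {i j k} → i ≢ j →
  f i ≡ 1ℤ → f j ≡ 1ℤ → f k ≡ -1ℤ → (∀ x → f x ≢ 0ℤ → x ∈ i ∷ j ∷ k ∷ []) →
  Alternates f ⇔ Between (toℕ i) (toℕ k) (toℕ j)
alternating-three f {i} {j} {k} i≢j fi fj fk supp with Fin.<-cmp i j
... | tri< i<j _ _ = alternating-three-ordered f i<j fi fj fk supp
... | tri≈ _ i≡j _ = ⊥-elim (i≢j i≡j)
... | tri> _ _ j<i = mk⇔ (between-sym ∘ to) (from ∘ between-sym)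
  where open Equivalence (alternating-three-ordered f j<i fj fi fk (λ x → ∈-resp-↭ (↭.swap i j ↭.refl) ∘ supp x))

module Cycle {a : ℕ} (2≤a : 2 ≤ a) where

  next : Fin a → Fin a
  next = cnext a 2≤a

  private
    instance
      a-nonZero : NonZero a
      a-nonZero = >-nonZero (ℕ.≤-trans (s≤s z≤n) 2≤a)

    1≢a : 1 ≢ a
    1≢a 1≡a = ℕ.<-irrefl refl (subst (2 ≤_) (sym 1≡a) 2≤a)

  toℕ-next : ∀ i → toℕ (next i) ≡ suc (toℕ i) ⊎ (toℕ (next i) ≡ 0 × suc (toℕ i) ≡ a)
  toℕ-next i with ℕ.m≤n⇒m<n∨m≡n (toℕ<n i)
  ... | inj₁ i+1<a = inj₁ (trans (toℕ-fromℕ< _) (m<n⇒m%n≡m i+1<a))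
  ... | inj₂ i+1≡a = inj₂ (trans (toℕ-fromℕ< _) (trans (cong (_% a) i+1≡a) (n%n≡0 a)) , i+1≡a)

  next-injective : Injective _≡_ _≡_ next
  next-injective {i} {j} eq with toℕ-next i | toℕ-next j
  ... | inj₁ p | inj₁ q = toℕ-injective (ℕ.suc-injective (trans (sym p) (trans (cong toℕ eq) q)))
  ... | inj₂ (_ , p) | inj₂ (_ , q) = toℕ-injective (ℕ.suc-injective (trans p (sym q)))
  ... | inj₁ p | inj₂ (q , _) with () ← trans (sym p) (trans (cong toℕ eq) q)
  ... | inj₂ (p , _) | inj₁ q with () ← trans (sym q) (trans (cong toℕ (sym eq)) p)

  next-irreflexive : ∀ i → next i ≢ i
  next-irreflexive i eq with toℕ-next i
  ... | inj₁ p = ℕ.1+n≢n (trans (sym p) (cong toℕ eq))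
  ... | inj₂ (p , i+1≡a) = 1≢a (trans (sym (cong suc (trans (cong toℕ (sym eq)) p))) i+1≡a)

  next²≡id⇒a≡2 : ∀ i → next (next i) ≡ i → a ≡ 2
  next²≡id⇒a≡2 i eq with toℕ-next i | toℕ-next (next i)
  ... | inj₁ p | inj₁ q = ⊥-elim (ℕ.<-irrefl (trans (cong toℕ (sym eq)) (trans q (cong suc p))) (ℕ.<-trans (ℕ.n<1+n _) (ℕ.n<1+n _)))
  ... | inj₁ p | inj₂ (q , q′) = trans (sym q′) (cong suc (trans p (cong suc (trans (cong toℕ (sym eq)) q))))
  ... | inj₂ (p , p′) | inj₁ q = trans (sym p′) (cong suc (trans (sym (cong toℕ eq)) (trans q (cong suc p))))
  ... | inj₂ (p , p′) | inj₂ (q , q′) = ⊥-elim (1≢a (trans (cong suc (sym p)) q′))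

  two-cycle-next : a ≡ 2 → ∀ {i j} → i ≢ j → next i ≡ j
  two-cycle-next refl {Fin.zero}          {Fin.zero}          i≢j = ⊥-elim (i≢j refl)
  two-cycle-next refl {Fin.zero}          {Fin.suc Fin.zero}  _   = refl
  two-cycle-next refl {Fin.suc Fin.zero}  {Fin.zero}          _   = refl
  two-cycle-next refl {Fin.suc Fin.zero}  {Fin.suc Fin.zero}  i≢j = ⊥-elim (i≢j refl)

  prev : Fin a → Fin a
  prev i = proj₁ (injective⇒surjective next next-injective i)

  next-prev : ∀ i → next (prev i) ≡ i
  next-prev i = proj₂ (injective⇒surjective next next-injective i)

  prev-next : ∀ i → prev (next i) ≡ i
  prev-next i = next-injective (next-prev (next i))

  next≡⇒prev≡ : ∀ {i j} → next j ≡ i → prev i ≡ j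
  next≡⇒prev≡ {j = j} e = trans (cong prev (sym e)) (prev-next j)

  prev≡⇒next≡ : ∀ {i j} → prev i ≡ j → next j ≡ i
  prev≡⇒next≡ {i} e = trans (cong next (sym e)) (next-prev i)

  prev-injective : Injective _≡_ _≡_ prev
  prev-injective {i} {j} e = trans (sym (next-prev i)) (trans (cong next e) (next-prev j))

  prev-irreflexive : ∀ i → prev i ≢ i
  prev-irreflexive i e = next-irreflexive i (prev≡⇒next≡ e)

assocLookup : ∀ {a} {A : Set a} → DecidableEquality A → List (A × ℕ) → A → ℕ
assocLookup _≟_ []            x = 0
assocLookup _≟_ ((y , k) ∷ l) x = if does (y ≟ x) then k else assocLookup _≟_ l x

if-does-yes : ∀ {p b} {P : Set p} {B : Set b} (d : Dec P) {t e : B} → P → (if does d then t else e) ≡ t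
if-does-yes d {t} {e} p = cong (if_then t else e) (dec-true d p)

if-does-no : ∀ {p b} {P : Set p} {B : Set b} (d : Dec P) {t e : B} → ¬ P → (if does d then t else e) ≡ e
if-does-no d {t} {e} ¬p = cong (if_then t else e) (dec-false d ¬p)

module Graph {n} (Γ : PT2c n) where
  open PT2c Γ
  module C₁ = Cycle 2≤a
  module C₂ = Cycle 2≤b

  prev₁ : Fin a → Fin a
  prev₁ = C₁.prev

  prev₂ : Fin b → Fin b
  prev₂ = C₂.prev

  U₁ U₂ U₁⁺ U₂⁺ V₁ V₂ V₁⁻ V₂⁻ : Fin n
  U₁  = c₁ u₁
  U₂  = c₁ u₂
  U₁⁺ = c₁ (next₁ u₁)
  U₂⁺ = c₁ (next₁ u₂)
  V₁  = c₂ v₁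
  V₂  = c₂ v₂
  V₁⁻ = c₂ (prev₂ v₁)
  V₂⁻ = c₂ (prev₂ v₂)

  Arc : Fin n → Fin n → Set
  Arc x y = Blue x y ⊎ Red x y

  arc-from-cycle₁ : ∀ {i y} → i ≢ u₁ → i ≢ u₂ → Arc (c₁ i) y → y ≡ c₁ (next₁ i)
  arc-from-cycle₁ _   _   (inj₁ (inj₁ (_ , e , e′))) with refl ← c₁-inj e = e′
  arc-from-cycle₁ _   _   (inj₁ (inj₂ (inj₁ (j , e , _)))) = ⊥-elim (disj _ j e)
  arc-from-cycle₁ ≢u₁ _   (inj₁ (inj₂ (inj₂ (inj₁ (e , _))))) = ⊥-elim (≢u₁ (c₁-inj e))
  arc-from-cycle₁ _   ≢u₂ (inj₁ (inj₂ (inj₂ (inj₂ (e , _))))) = ⊥-elim (≢u₂ (c₁-inj e))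
  arc-from-cycle₁ ≢u₁ _   (inj₂ (inj₁ (e , _))) = ⊥-elim (≢u₁ (c₁-inj e))
  arc-from-cycle₁ _   ≢u₂ (inj₂ (inj₂ (e , _))) = ⊥-elim (≢u₂ (c₁-inj e))

  arc-from-cycle₂ : ∀ {j y} → Arc (c₂ j) y → y ≡ c₂ (next₂ j)
  arc-from-cycle₂ (inj₁ (inj₁ (i , e , _))) = ⊥-elim (disj i _ (sym e))
  arc-from-cycle₂ (inj₁ (inj₂ (inj₁ (_ , e , e′)))) with refl ← c₂-inj e = e′
  arc-from-cycle₂ (inj₁ (inj₂ (inj₂ (inj₁ (e , _))))) = ⊥-elim (disj _ _ (sym e))
  arc-from-cycle₂ (inj₁ (inj₂ (inj₂ (inj₂ (e , _))))) = ⊥-elim (disj _ _ (sym e))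
  arc-from-cycle₂ (inj₂ (inj₁ (e , _))) = ⊥-elim (disj _ _ (sym e))
  arc-from-cycle₂ (inj₂ (inj₂ (e , _))) = ⊥-elim (disj _ _ (sym e))

  arc-from-U₁ : ∀ {y} → Arc U₁ y → y ∈ U₁⁺ ∷ V₂ ∷ V₁ ∷ []
  arc-from-U₁ (inj₁ (inj₁ (_ , e , e′))) with refl ← c₁-inj e = here e′
  arc-from-U₁ (inj₁ (inj₂ (inj₁ (j , e , _)))) = ⊥-elim (disj _ j e)
  arc-from-U₁ (inj₁ (inj₂ (inj₂ (inj₁ (_ , e))))) = there (here e)
  arc-from-U₁ (inj₁ (inj₂ (inj₂ (inj₂ (e , _))))) = ⊥-elim (u₁≢u₂ (c₁-inj e))
  arc-from-U₁ (inj₂ (inj₁ (_ , e))) = there (there (here e))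
  arc-from-U₁ (inj₂ (inj₂ (e , _))) = ⊥-elim (u₁≢u₂ (c₁-inj e))

  arc-from-U₂ : ∀ {y} → Arc U₂ y → y ∈ U₂⁺ ∷ V₁ ∷ V₂ ∷ []
  arc-from-U₂ (inj₁ (inj₁ (_ , e , e′))) with refl ← c₁-inj e = here e′
  arc-from-U₂ (inj₁ (inj₂ (inj₁ (j , e , _)))) = ⊥-elim (disj _ j e)
  arc-from-U₂ (inj₁ (inj₂ (inj₂ (inj₁ (e , _))))) = ⊥-elim (u₁≢u₂ (sym (c₁-inj e)))
  arc-from-U₂ (inj₁ (inj₂ (inj₂ (inj₂ (_ , e))))) = there (here e)
  arc-from-U₂ (inj₂ (inj₁ (e , _))) = ⊥-elim (u₁≢u₂ (sym (c₁-inj e)))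
  arc-from-U₂ (inj₂ (inj₂ (_ , e))) = there (there (here e))

  arc-into-cycle₁ : ∀ {x i} → Arc x (c₁ i) → x ≡ c₁ (prev₁ i)
  arc-into-cycle₁ (inj₁ (inj₁ (_ , e , e′))) = trans e (cong c₁ (sym (C₁.next≡⇒prev≡ (sym (c₁-inj e′)))))
  arc-into-cycle₁ (inj₁ (inj₂ (inj₁ (_ , _ , e)))) = ⊥-elim (disj _ _ e)
  arc-into-cycle₁ (inj₁ (inj₂ (inj₂ (inj₁ (_ , e))))) = ⊥-elim (disj _ _ e)
  arc-into-cycle₁ (inj₁ (inj₂ (inj₂ (inj₂ (_ , e))))) = ⊥-elim (disj _ _ e)
  arc-into-cycle₁ (inj₂ (inj₁ (_ , e))) = ⊥-elim (disj _ _ e)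
  arc-into-cycle₁ (inj₂ (inj₂ (_ , e))) = ⊥-elim (disj _ _ e)

  arc-into-cycle₂ : ∀ {x j} → j ≢ v₁ → j ≢ v₂ → Arc x (c₂ j) → x ≡ c₂ (prev₂ j)
  arc-into-cycle₂ _   _   (inj₁ (inj₁ (_ , _ , e))) = ⊥-elim (disj _ _ (sym e))
  arc-into-cycle₂ _   _   (inj₁ (inj₂ (inj₁ (_ , e , e′)))) = trans e (cong c₂ (sym (C₂.next≡⇒prev≡ (sym (c₂-inj e′)))))
  arc-into-cycle₂ _   ≢v₂ (inj₁ (inj₂ (inj₂ (inj₁ (_ , e))))) = ⊥-elim (≢v₂ (c₂-inj e))
  arc-into-cycle₂ ≢v₁ _   (inj₁ (inj₂ (inj₂ (inj₂ (_ , e))))) = ⊥-elim (≢v₁ (c₂-inj e))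
  arc-into-cycle₂ ≢v₁ _   (inj₂ (inj₁ (_ , e))) = ⊥-elim (≢v₁ (c₂-inj e))
  arc-into-cycle₂ _   ≢v₂ (inj₂ (inj₂ (_ , e))) = ⊥-elim (≢v₂ (c₂-inj e))

  arc-into-V₁ : ∀ {x} → Arc x V₁ → x ∈ V₁⁻ ∷ U₂ ∷ U₁ ∷ []
  arc-into-V₁ (inj₁ (inj₁ (_ , _ , e))) = ⊥-elim (disj _ _ (sym e))
  arc-into-V₁ (inj₁ (inj₂ (inj₁ (_ , e , e′)))) = here (trans e (cong c₂ (sym (C₂.next≡⇒prev≡ (sym (c₂-inj e′))))))
  arc-into-V₁ (inj₁ (inj₂ (inj₂ (inj₁ (_ , e))))) = ⊥-elim (v₁≢v₂ (c₂-inj e))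
  arc-into-V₁ (inj₁ (inj₂ (inj₂ (inj₂ (e , _))))) = there (here e)
  arc-into-V₁ (inj₂ (inj₁ (e , _))) = there (there (here e))
  arc-into-V₁ (inj₂ (inj₂ (_ , e))) = ⊥-elim (v₁≢v₂ (c₂-inj e))

  arc-into-V₂ : ∀ {x} → Arc x V₂ → x ∈ V₂⁻ ∷ U₁ ∷ U₂ ∷ []
  arc-into-V₂ (inj₁ (inj₁ (_ , _ , e))) = ⊥-elim (disj _ _ (sym e))
  arc-into-V₂ (inj₁ (inj₂ (inj₁ (_ , e , e′)))) = here (trans e (cong c₂ (sym (C₂.next≡⇒prev≡ (sym (c₂-inj e′))))))
  arc-into-V₂ (inj₁ (inj₂ (inj₂ (inj₁ (e , _))))) = there (here e)
  arc-into-V₂ (inj₁ (inj₂ (inj₂ (inj₂ (_ , e))))) = ⊥-elim (v₁≢v₂ (sym (c₂-inj e)))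
  arc-into-V₂ (inj₂ (inj₁ (_ , e))) = ⊥-elim (v₁≢v₂ (sym (c₂-inj e)))
  arc-into-V₂ (inj₂ (inj₂ (e , _))) = there (there (here e))

  entry : Fin n → Fin n → ℤ
  entry = matrix id

  entry-blue : ∀ {x y} → Blue x y → entry x y ≡ 1ℤ
  entry-blue {x} {y} b with blue? x y
  ... | yes _ = refl
  ... | no ¬b = ⊥-elim (¬b b)

  entry-red : ∀ {x y} → ¬ Blue x y → Red x y → entry x y ≡ -1ℤ
  entry-red {x} {y} ¬b r with blue? x y | red? x y
  ... | yes b | _     = ⊥-elim (¬b b)
  ... | no _  | yes _ = refl
  ... | no _  | no ¬r = ⊥-elim (¬r r)

  entry≢0⇒arc : ∀ {x y} → entry x y ≢ 0ℤ → Arc x y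
  entry≢0⇒arc {x} {y} e≢0 with blue? x y | red? x y
  ... | yes b | _     = inj₁ b
  ... | no _  | yes r = inj₂ r
  ... | no _  | no _  = ⊥-elim (e≢0 refl)

  entry-values : ∀ x y → entry x y ≡ 0ℤ ⊎ entry x y ≡ 1ℤ ⊎ entry x y ≡ -1ℤ
  entry-values x y with blue? x y | red? x y
  ... | yes _ | _     = inj₂ (inj₁ refl)
  ... | no _  | yes _ = inj₂ (inj₂ refl)
  ... | no _  | no _  = inj₁ refl

  ¬blue-U₁V₁ : ¬ Blue U₁ V₁
  ¬blue-U₁V₁ (inj₁ (_ , _ , e))            = disj _ _ (sym e)
  ¬blue-U₁V₁ (inj₂ (inj₁ (_ , e , _)))     = disj _ _ e
  ¬blue-U₁V₁ (inj₂ (inj₂ (inj₁ (_ , e))))  = v₁≢v₂ (c₂-inj e)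
  ¬blue-U₁V₁ (inj₂ (inj₂ (inj₂ (e , _))))  = u₁≢u₂ (c₁-inj e)

  ¬blue-U₂V₂ : ¬ Blue U₂ V₂
  ¬blue-U₂V₂ (inj₁ (_ , _ , e))            = disj _ _ (sym e)
  ¬blue-U₂V₂ (inj₂ (inj₁ (_ , e , _)))     = disj _ _ e
  ¬blue-U₂V₂ (inj₂ (inj₂ (inj₁ (e , _))))  = u₁≢u₂ (sym (c₁-inj e))
  ¬blue-U₂V₂ (inj₂ (inj₂ (inj₂ (_ , e))))  = v₁≢v₂ (sym (c₂-inj e))

  slotsOf : (Fin n → ℕ) → Slots
  slotsOf κ = slots (κ U₁) (κ U₂) (κ U₁⁺) (κ U₂⁺) (κ V₁) (κ V₂) (κ V₁⁻) (κ V₂⁻)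

  Chains : (Fin n → ℕ) → Set
  Chains κ = Chained (slotsOf κ)

  chains-map : ∀ {κ κ′ : Fin n → ℕ} → (∀ {x y} → κ x < κ y → κ′ x < κ′ y) → Chains κ → Chains κ′
  chains-map {κ} {κ′} mono (b₁ , b₂ , b₃ , b₄) = transfer b₁ , transfer b₂ , transfer b₃ , transfer b₄
    where
    transfer : ∀ {x m y} → Between (κ x) (κ m) (κ y) → Between (κ′ x) (κ′ m) (κ′ y)
    transfer = between-map {f = κ} {g = κ′} mono

  module Ordering (w pos : Fin n → Fin n) (w∘pos : ∀ x → w (pos x) ≡ x) (pos∘w : ∀ i → pos (w i) ≡ i) where

    position : Fin n → ℕ
    position = toℕ ∘ pos

    line-value : ∀ (g : Fin n → ℤ) {x z} → g x ≡ z → (g ∘ w) (pos x) ≡ z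
    line-value g {x} gx≡z = trans (cong g (w∘pos x)) gx≡z

    line-support : ∀ (g : Fin n → ℤ) {vs} → (∀ y → g y ≢ 0ℤ → y ∈ vs) →
                   ∀ i → (g ∘ w) i ≢ 0ℤ → i ∈ map pos vs
    line-support g supp i gwi≢0 = subst (_∈ _) (pos∘w i) (∈-map⁺ pos (supp (w i) gwi≢0))

    ordinary-line : ∀ (g : Fin n → ℤ) {s} → g s ≡ 1ℤ → (∀ y → g y ≢ 0ℤ → y ≡ s) →
                    Alternates (g ∘ w)
    ordinary-line g gs supp = alternating-single (g ∘ w) (line-value g gs) (line-support g (λ y → here ∘ supp y))

    special-line : ∀ (g : Fin n → ℤ) {s t r} → s ≢ t → g s ≡ 1ℤ → g t ≡ 1ℤ → g r ≡ -1ℤ →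
                   (∀ y → g y ≢ 0ℤ → y ∈ s ∷ t ∷ r ∷ []) →
                   Alternates (g ∘ w) ⇔ Between (position s) (position r) (position t)
    special-line g s≢t gs gt gr supp =
      alternating-three (g ∘ w) (λ e → s≢t (trans (sym (w∘pos _)) (trans (cong w e) (w∘pos _))))
        (line-value g gs) (line-value g gt) (line-value g gr) (line-support g supp)

    row column : Fin n → Fin n → ℤ
    row x = entry x ∘ w
    column y = (λ x → entry x y) ∘ w

    row-cycle₁ : ∀ {i} → i ≢ u₁ → i ≢ u₂ → Alternates (row (c₁ i))
    row-cycle₁ {i} ≢u₁ ≢u₂ = ordinary-line (entry (c₁ i)) (entry-blue (inj₁ (i , refl , refl)))
      (λ _ → arc-from-cycle₁ ≢u₁ ≢u₂ ∘ entry≢0⇒arc)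

    row-cycle₂ : ∀ j → Alternates (row (c₂ j))
    row-cycle₂ j = ordinary-line (entry (c₂ j)) (entry-blue (inj₂ (inj₁ (j , refl , refl))))
      (λ _ → arc-from-cycle₂ ∘ entry≢0⇒arc)

    column-cycle₁ : ∀ i → Alternates (column (c₁ i))
    column-cycle₁ i = ordinary-line (λ x → entry x (c₁ i))
      (entry-blue (inj₁ (prev₁ i , refl , cong c₁ (sym (C₁.next-prev i)))))
      (λ _ → arc-into-cycle₁ ∘ entry≢0⇒arc)

    column-cycle₂ : ∀ {j} → j ≢ v₁ → j ≢ v₂ → Alternates (column (c₂ j))
    column-cycle₂ {j} ≢v₁ ≢v₂ = ordinary-line (λ x → entry x (c₂ j))
      (entry-blue (inj₂ (inj₁ (prev₂ j , refl , cong c₂ (sym (C₂.next-prev j))))))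
      (λ _ → arc-into-cycle₂ ≢v₁ ≢v₂ ∘ entry≢0⇒arc)

    row-U₁ : Alternates (row U₁) ⇔ Between (position U₁⁺) (position V₁) (position V₂)
    row-U₁ = special-line (entry U₁) (disj _ _)
      (entry-blue (inj₁ (u₁ , refl , refl))) (entry-blue (inj₂ (inj₂ (inj₁ (refl , refl)))))
      (entry-red ¬blue-U₁V₁ (inj₁ (refl , refl))) (λ _ → arc-from-U₁ ∘ entry≢0⇒arc)

    row-U₂ : Alternates (row U₂) ⇔ Between (position U₂⁺) (position V₂) (position V₁)
    row-U₂ = special-line (entry U₂) (disj _ _)
      (entry-blue (inj₁ (u₂ , refl , refl))) (entry-blue (inj₂ (inj₂ (inj₂ (refl , refl)))))
      (entry-red ¬blue-U₂V₂ (inj₂ (refl , refl))) (λ _ → arc-from-U₂ ∘ entry≢0⇒arc)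

    column-V₁ : Alternates (column V₁) ⇔ Between (position V₁⁻) (position U₁) (position U₂)
    column-V₁ = special-line (λ x → entry x V₁) (disj _ _ ∘ sym)
      (entry-blue (inj₂ (inj₁ (prev₂ v₁ , refl , cong c₂ (sym (C₂.next-prev v₁))))))
      (entry-blue (inj₂ (inj₂ (inj₂ (refl , refl)))))
      (entry-red ¬blue-U₁V₁ (inj₁ (refl , refl))) (λ _ → arc-into-V₁ ∘ entry≢0⇒arc)

    column-V₂ : Alternates (column V₂) ⇔ Between (position V₂⁻) (position U₂) (position U₁)
    column-V₂ = special-line (λ x → entry x V₂) (disj _ _ ∘ sym)
      (entry-blue (inj₂ (inj₁ (prev₂ v₂ , refl , cong c₂ (sym (C₂.next-prev v₂))))))
      (entry-blue (inj₂ (inj₂ (inj₁ (refl , refl)))))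
      (entry-red ¬blue-U₂V₂ (inj₂ (refl , refl))) (λ _ → arc-into-V₂ ∘ entry≢0⇒arc)

    rows-alternate : Chains position → ∀ x → Alternates (row x)
    rows-alternate (b₁ , b₂ , _ , _) x with cover x
    ... | inj₂ (j , refl) = row-cycle₂ j
    ... | inj₁ (i , refl) with i ≟ᶠ u₁ | i ≟ᶠ u₂
    ...   | yes refl | _        = Equivalence.from row-U₁ b₁
    ...   | no _     | yes refl = Equivalence.from row-U₂ b₂
    ...   | no ≢u₁   | no ≢u₂   = row-cycle₁ ≢u₁ ≢u₂

    columns-alternate : Chains position → ∀ y → Alternates (column y)
    columns-alternate (_ , _ , b₃ , b₄) y with cover y
    ... | inj₁ (i , refl) = column-cycle₁ i
    ... | inj₂ (j , refl) with j ≟ᶠ v₁ | j ≟ᶠ v₂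
    ...   | yes refl | _        = Equivalence.from column-V₁ b₃
    ...   | no _     | yes refl = Equivalence.from column-V₂ b₄
    ...   | no ≢v₁   | no ≢v₂   = column-cycle₂ ≢v₁ ≢v₂

    isASM⇔chains : IsASM (matrix w) ⇔ Chains position
    isASM⇔chains = mk⇔ to from
      where
      to : IsASM (matrix w) → Chains position
      to (_ , rows , columns) =
          Equivalence.to row-U₁ (row-at U₁) , Equivalence.to row-U₂ (row-at U₂)
        , Equivalence.to column-V₁ (column-at V₁) , Equivalence.to column-V₂ (column-at V₂)
        where
        row-at : ∀ x → Alternates (row x)
        row-at x = subst (Alternates ∘ row) (w∘pos x) (rows (pos x))
        column-at : ∀ y → Alternates (column y)
        column-at y = subst (Alternates ∘ column) (w∘pos y) (columns (pos y))
      from : Chains position → IsASM (matrix w)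
      from ch = (λ i j → entry-values (w i) (w j))
              , (λ i → rows-alternate ch (w i)) , (λ j → columns-alternate ch (w j))

  ManyCoincidences : Set
  ManyCoincidences = AtLeastThree (next₁ u₁ ≡ u₂) (next₁ u₂ ≡ u₁) (prev₂ v₁ ≡ v₂) (prev₂ v₂ ≡ v₁)

  exceptional⇔manyCoincidences : Exceptional ⇔ ManyCoincidences
  exceptional⇔manyCoincidences = mk⇔ to from
    where
    to : Exceptional → ManyCoincidences
    to (inj₁ (a≡2 , consecutive)) =
      inj₁ ( C₁.two-cycle-next a≡2 u₁≢u₂ , C₁.two-cycle-next a≡2 (u₁≢u₂ ∘ sym)
           , Sum.swap (Sum.map (C₂.next≡⇒prev≡ ∘ sym) (C₂.next≡⇒prev≡ ∘ sym) consecutive))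
    to (inj₂ (b≡2 , consecutive)) =
      inj₂ ( C₂.next≡⇒prev≡ (C₂.two-cycle-next b≡2 (v₁≢v₂ ∘ sym))
           , C₂.next≡⇒prev≡ (C₂.two-cycle-next b≡2 v₁≢v₂)
           , Sum.map sym sym consecutive)
    from : ManyCoincidences → Exceptional
    from (inj₁ (e₁ , e₂ , e₃₄)) =
      inj₁ ( C₁.next²≡id⇒a≡2 u₁ (trans (cong next₁ e₁) e₂)
           , Sum.swap (Sum.map (sym ∘ C₂.prev≡⇒next≡) (sym ∘ C₂.prev≡⇒next≡) e₃₄))
    from (inj₂ (e₃ , e₄ , e₁₂)) =
      inj₂ ( C₂.next²≡id⇒a≡2 v₁ (trans (cong next₂ (C₂.prev≡⇒next≡ e₄)) (C₂.prev≡⇒next≡ e₃))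
           , Sum.map sym sym e₁₂)

  chains⇒¬exceptional : ∃ Chains → ¬ Exceptional
  chains⇒¬exceptional (κ , ch) =
    chained⇒¬AtLeastThree ch
    ∘ AtLeastThree-map (cong (κ ∘ c₁)) (cong (κ ∘ c₁)) (cong (κ ∘ c₂)) (cong (κ ∘ c₂))
    ∘ Equivalence.to exceptional⇔manyCoincidences

  module Placement (k₁ k₂ k₁⁺ k₂⁺ l₁ l₂ l₁⁻ l₂⁻ : ℕ) where

    -- The first matching entry wins, so coinciding slots take the key of the earlier one.
    key : Fin n → ℕ
    key = assocLookup _≟ᶠ_
      ((U₁ , k₁) ∷ (U₂ , k₂) ∷ (U₁⁺ , k₁⁺) ∷ (U₂⁺ , k₂⁺) ∷ (V₁ , l₁) ∷ (V₂ , l₂) ∷ (V₁⁻ , l₁⁻) ∷ (V₂⁻ , l₂⁻) ∷ [])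

    private
      hit : ∀ (x : Fin n) {k r : ℕ} → (if does (x ≟ᶠ x) then k else r) ≡ k
      hit x = if-does-yes (x ≟ᶠ x) refl

      skip : ∀ (y x : Fin n) {k r : ℕ} → y ≢ x → (if does (y ≟ᶠ x) then k else r) ≡ r
      skip y x = if-does-no (y ≟ᶠ x)

      c₁-≢ : ∀ {i i′} → i ≢ i′ → c₁ i ≢ c₁ i′
      c₁-≢ i≢i′ = i≢i′ ∘ c₁-inj

      c₂-≢ : ∀ {j j′} → j ≢ j′ → c₂ j ≢ c₂ j′
      c₂-≢ j≢j′ = j≢j′ ∘ c₂-inj

      skip-cycle₁ : ∀ j → key (c₂ j) ≡ assocLookup _≟ᶠ_ ((V₁ , l₁) ∷ (V₂ , l₂) ∷ (V₁⁻ , l₁⁻) ∷ (V₂⁻ , l₂⁻) ∷ []) (c₂ j)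
      skip-cycle₁ j = trans (skip U₁ (c₂ j) (disj _ _)) (trans (skip U₂ (c₂ j) (disj _ _))
                        (trans (skip U₁⁺ (c₂ j) (disj _ _)) (skip U₂⁺ (c₂ j) (disj _ j))))

    key-U₁ : key U₁ ≡ k₁
    key-U₁ = hit U₁

    key-U₂ : key U₂ ≡ k₂
    key-U₂ = trans (skip U₁ U₂ (c₁-≢ u₁≢u₂)) (hit U₂)

    key-U₁⁺ : key U₁⁺ ≡ (if does (next₁ u₁ ≟ᶠ u₂) then k₂ else k₁⁺)
    key-U₁⁺ with next₁ u₁ ≟ᶠ u₂
    ... | yes e = trans (cong (key ∘ c₁) e) key-U₂
    ... | no ne = trans (skip U₁ U₁⁺ (c₁-≢ (C₁.next-irreflexive u₁ ∘ sym)))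
                    (trans (skip U₂ U₁⁺ (c₁-≢ (ne ∘ sym))) (hit U₁⁺))

    key-U₂⁺ : key U₂⁺ ≡ (if does (next₁ u₂ ≟ᶠ u₁) then k₁ else k₂⁺)
    key-U₂⁺ with next₁ u₂ ≟ᶠ u₁
    ... | yes e = trans (cong (key ∘ c₁) e) key-U₁
    ... | no ne = trans (skip U₁ U₂⁺ (c₁-≢ (ne ∘ sym))) (trans (skip U₂ U₂⁺ (c₁-≢ (C₁.next-irreflexive u₂ ∘ sym)))
                    (trans (skip U₁⁺ U₂⁺ (c₁-≢ (u₁≢u₂ ∘ C₁.next-injective))) (hit U₂⁺)))

    key-V₁ : key V₁ ≡ l₁
    key-V₁ = trans (skip-cycle₁ v₁) (hit V₁)

    key-V₂ : key V₂ ≡ l₂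
    key-V₂ = trans (skip-cycle₁ v₂) (trans (skip V₁ V₂ (c₂-≢ v₁≢v₂)) (hit V₂))

    key-V₁⁻ : key V₁⁻ ≡ (if does (prev₂ v₁ ≟ᶠ v₂) then l₂ else l₁⁻)
    key-V₁⁻ with prev₂ v₁ ≟ᶠ v₂
    ... | yes e = trans (cong (key ∘ c₂) e) key-V₂
    ... | no ne = trans (skip-cycle₁ (prev₂ v₁)) (trans (skip V₁ V₁⁻ (c₂-≢ (C₂.prev-irreflexive v₁ ∘ sym)))
                    (trans (skip V₂ V₁⁻ (c₂-≢ (ne ∘ sym))) (hit V₁⁻)))

    key-V₂⁻ : key V₂⁻ ≡ (if does (prev₂ v₂ ≟ᶠ v₁) then l₁ else l₂⁻)
    key-V₂⁻ with prev₂ v₂ ≟ᶠ v₁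
    ... | yes e = trans (cong (key ∘ c₂) e) key-V₁
    ... | no ne = trans (skip-cycle₁ (prev₂ v₂)) (trans (skip V₁ V₂⁻ (c₂-≢ (ne ∘ sym)))
                    (trans (skip V₂ V₂⁻ (c₂-≢ (C₂.prev-irreflexive v₂ ∘ sym)))
                    (trans (skip V₁⁻ V₂⁻ (c₂-≢ (v₁≢v₂ ∘ C₂.prev-injective))) (hit V₂⁻))))

  placementKey : Slots → Fin n → ℕ
  placementKey (slots k₁ k₂ k₁⁺ k₂⁺ l₁ l₂ l₁⁻ l₂⁻) = Placement.key k₁ k₂ k₁⁺ k₂⁺ l₁ l₂ l₁⁻ l₂⁻

  slotsOf-placementKey : ∀ s → slotsOf (placementKey s) ≡
    coincide s (does (next₁ u₁ ≟ᶠ u₂)) (does (next₁ u₂ ≟ᶠ u₁)) (does (prev₂ v₁ ≟ᶠ v₂)) (does (prev₂ v₂ ≟ᶠ v₁))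
  slotsOf-placementKey (slots k₁ k₂ k₁⁺ k₂⁺ l₁ l₂ l₁⁻ l₂⁻) =
    slots-≡ key-U₁ key-U₂ key-U₁⁺ key-U₂⁺ key-V₁ key-V₂ key-V₁⁻ key-V₂⁻
    where open Placement k₁ k₂ k₁⁺ k₂⁺ l₁ l₂ l₁⁻ l₂⁻

  ¬exceptional⇒chains : ¬ Exceptional → ∃ Chains
  ¬exceptional⇒chains ¬exc
    with s , ch ← chained-placement (next₁ u₁ ≟ᶠ u₂) (next₁ u₂ ≟ᶠ u₁) (prev₂ v₁ ≟ᶠ v₂) (prev₂ v₂ ≟ᶠ v₁)
                    (¬exc ∘ Equivalence.from exceptional⇔manyCoincidences)
    = placementKey s , subst Chained (sym (slotsOf-placementKey s)) ch

  ASMOrdering : Set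
  ASMOrdering = Σ (Fin n → Fin n) λ w → Bijective _≡_ _≡_ w × IsASM (matrix w)

  chains⇒asm : ∃ Chains → ASMOrdering
  chains⇒asm (κ , ch) =
    ordering , ordering-bijective ,
    Equivalence.from (Ordering.isASM⇔chains ordering position ordering∘position position∘ordering)
      (chains-map (λ {x} {y} κx<κy → position-mono {x} {y} (inj₁ κx<κy)) ch)
    where open Ranking (keyOrder-isStrictTotalOrder κ)

  asm⇒chains : ASMOrdering → ∃ Chains
  asm⇒chains (w , (w-injective , w-surjective) , asm) =
    toℕ ∘ pos , Equivalence.to (Ordering.isASM⇔chains w pos w∘pos (λ i → w-injective (w∘pos (w i)))) asm
    where
    pos : Fin n → Fin n
    pos x = proj₁ (w-surjective x)
    w∘pos : ∀ x → w (pos x) ≡ x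
    w∘pos x = proj₂ (w-surjective x) refl

theorem5p2 : (n : ℕ) → (Γ : PT2c n) →
    (Σ (Fin n → Fin n) (λ w → Bijective _≡_ _≡_ w × IsASM (PT2c.matrix Γ w)))
      ⇔ (¬ PT2c.Exceptional Γ)
theorem5p2 n Γ = mk⇔ (chains⇒¬exceptional ∘ asm⇒chains) (chains⇒asm ∘ ¬exceptional⇒chains)
  where open Graph Γ
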